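{- Let $\mathcal{A}_n$ denote the $n$-th associahedron graph (defined in the context). Then the chromatic number satisfies $\chi(\mathcal{A}_n) = O(\log n)$; that is, there is an absolute constant $K$ such that $\chi(\mathcal{A}_n) \le K \log n$ for all $n \ge 4$.
   Context: For $n \ge 3$, consider the convex $n$-gon whose vertices are labelled $0,1,\ldots,n-1$ in clockwise order. The graph $\mathcal{A}_n$ (the 1-skeleton of the associahedron) has as vertices all triangulations of this polygon. A triangulation $T$ contains the boundary edges $01,12,\ldots,(n-1)0$; each non-boundary edge $e$ of $T$ is a diagonal of a unique quadrilateral formed by the two triangles of $T$ containing $e$, and flipping $e$ means replacing $e$ by the other diagonal of this quadrilateral. Two triangulations are adjacent in $\mathcal{A}_n$ if one is obtained from the other by a single flip. $\chi$ denotes the chromatic number. -}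

module Defs where

open import Data.Nat using (ℕ; zero; suc; _+_; _∸_; _<_; _≤_)
open import Data.Fin using (Fin; toℕ)
open import Data.Fin.Properties using (_≟_)
open import Data.Bool using (Bool; true; false; if_then_else_; _∧_)
open import Data.Product using (Σ; ∃; ∃-syntax; _×_; _,_)
open import Data.Sum using (_⊎_)
open import Relation.Nullary using (¬_; does)
open import Relation.Binary.PropositionalEquality using (_≡_; _≢_)

-- Vertices of the convex n-gon: Fin n, labelled 0..n-1 clockwise.
-- A segment between vertices i and j is always recorded with toℕ i < toℕ j.

Boundary : {n : ℕ} → Fin n → Fin n → Set
Boundary {n} i j = (toℕ j ≡ suc (toℕ i)) ⊎ ((toℕ i ≡ 0) × (toℕ j ≡ n ∸ 1))

Diagonal : {n : ℕ} → Fin n → Fin n → Set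
Diagonal i j = (toℕ i < toℕ j) × ¬ Boundary i j

Cross : {n : ℕ} → Fin n → Fin n → Fin n → Fin n → Set
Cross i j k l =
  ((toℕ i < toℕ k) × (toℕ k < toℕ j) × (toℕ j < toℕ l)) ⊎
  ((toℕ k < toℕ i) × (toℕ i < toℕ l) × (toℕ l < toℕ j))

record Triangulation (n : ℕ) : Set where
  field
    edge      : Fin n → Fin n → Bool
    diag      : ∀ i j → edge i j ≡ true → Diagonal i j
    noncross  : ∀ i j k l → edge i j ≡ true → edge k l ≡ true → ¬ Cross i j k l
    maximal   : ∀ i j → Diagonal i j → edge i j ≡ false →
                ∃[ k ] ∃[ l ] (edge k l ≡ true × Cross i j k l)
open Triangulation public

InT : {n : ℕ} → Triangulation n → Fin n → Fin n → Set
InT T i j = (edge T i j ≡ true) ⊎ Boundary i j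

samePair : {n : ℕ} → Fin n → Fin n → Fin n → Fin n → Bool
samePair i j x y = does (i ≟ x) ∧ does (j ≟ y)

replace : {n : ℕ} → (Fin n → Fin n → Bool) → Fin n → Fin n → Fin n → Fin n →
          Fin n → Fin n → Bool
replace E x y u v i j =
  if samePair i j x y then false else (if samePair i j u v then true else E i j)

-- T' is obtained from T by one flip: there are vertices a<b<c<d such that
-- the quadrilateral abcd is the union of two triangles of T sharing the
-- diagonal e ∈ {ac, bd} of T (all four sides ab, bc, cd, ad belong to T),
-- and T' = T with e replaced by the other diagonal of abcd.
Flip : {n : ℕ} → Triangulation n → Triangulation n → Set
Flip {n} T T' = ∃[ a ] ∃[ b ] ∃[ c ] ∃[ d ]
  ( (toℕ a < toℕ b) × (toℕ b < toℕ c) × (toℕ c < toℕ d)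
  × InT T a b × InT T b c × InT T c d × InT T a d
  × ( ((edge T a c ≡ true) × (∀ i j → edge T' i j ≡ replace (edge T) a c b d i j))
    ⊎ ((edge T b d ≡ true) × (∀ i j → edge T' i j ≡ replace (edge T) b d a c i j)) ) )

ProperColoring : (n m : ℕ) → (Triangulation n → Fin m) → Set
ProperColoring n m col = ∀ T T' → Flip T T' → col T ≢ col T'

ChromaticAtMost : ℕ → ℕ → Set
ChromaticAtMost n m = Σ (Triangulation n → Fin m) (ProperColoring n m)

module Submission where

-- Give a pair of vertices i < j the level λ(i,j): the height of the lowest common ancestor of
-- the leaves i and j of a binary tree on 0, …, n-1, so that λ < ⌊log₂ n⌋ + 2.  For a < b < c
-- one has λ(a,c) = max(λ(a,b), λ(b,c)) and λ(a,b) ≠ λ(b,c).  A flip in the quadrilateral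
-- a < b < c < d exchanges the diagonals ac and bd, so the sum of λ over the diagonals of the
-- triangulation changes by λ(b,d) - λ(a,c), which is nonzero modulo ⌊log₂ n⌋ + 2 unless
-- λ(a,c) = λ(b,d).  In that case call (l,r) marked if the triangulation has an edge l'r and an
-- edge lr' with l < r' < r, both at level λ(l,r): the two facts above show that (a,d) is the only
-- pair that changes status, so the number of marked pairs changes parity.  Colouring by the two
-- residues uses 2(⌊log₂ n⌋ + 2) ≤ 4⌊log₂ n⌋ colours.

open import Defs
open import Data.Nat using (ℕ; _*_; _≤_)
open import Data.Nat.Logarithm using (⌊log₂_⌋)
open import Data.Product using (∃-syntax)

open import Data.Bool as Bool using (Bool; true; false; if_then_else_)
open import Data.Empty using (⊥)
open import Data.Fin as Fin using (Fin; toℕ; punchIn; inject≤; combine)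
open import Data.Fin.Properties
  using (toℕ<n; toℕ-injective; punchInᵢ≢i; any?; inject≤-injective; combine-injective; toℕ-fromℕ<)
open import Data.Nat as ℕ using (zero; suc; _+_; _∸_; _<_; _⊔_; _%_; z≤n; s≤s; z<s; ⌊_/2⌋; NonZero)
open import Data.Nat.DivMod using (m≡m%n+[m/n]*n; [m+kn]%n≡m%n; m<n⇒m%n≡m; m%n<n; _/_; _mod_)
open import Data.Nat.Logarithm using (⌊log₂⌋-mono-≤; ⌊log₂⌊n/2⌋⌋≡⌊log₂n⌋∸1; ⌊log₂[2^n]⌋≡n)
open import Data.Nat.Properties
open import Algebra.Properties.CommutativeMonoid.Sum +-0-commutativeMonoid using (sum; sum-remove; sum-cong-≗)
open import Data.Nat.Tactic.RingSolver using (solve-∀)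
open import Data.Product using (_×_; _,_; proj₁; proj₂)
open import Data.Sum using (_⊎_; inj₁; inj₂)
open import Function.Base using (_∘_)
open import Function.Bundles using (mk⇔)
open import Relation.Binary.Definitions using (tri<; tri≈; tri>)
open import Relation.Binary.PropositionalEquality
open import Relation.Nullary using (¬_; Dec; yes; no; does; contradiction)
open import Relation.Nullary.Decidable using (_×-dec_; _⊎-dec_; dec-true; dec-false; does-⇔)

-- The height of the lowest common ancestor of the leaves i and j in the binary tree on ℕ in which
-- ⌊ k /2⌋ is the parent of k.  The fuel f only ensures termination; it suffices whenever j ≤ f.
lcaHeight : ℕ → ℕ → ℕ → ℕ
lcaHeight zero    i j = 0
lcaHeight (suc f) i j with i ℕ.≟ j
... | yes _ = 0
... | no  _ = suc (lcaHeight f ⌊ i /2⌋ ⌊ j /2⌋)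

lcaHeight-refl : ∀ f i → lcaHeight f i i ≡ 0
lcaHeight-refl zero    i = refl
lcaHeight-refl (suc f) i with i ℕ.≟ i
... | yes _   = refl
... | no  i≢i = contradiction refl i≢i

lcaHeight-≡ : ∀ f {i j} → i ≡ j → lcaHeight f i j ≡ 0
lcaHeight-≡ f refl = lcaHeight-refl f _

lcaHeight-≢ : ∀ f {i j} → i ≢ j → lcaHeight (suc f) i j ≡ suc (lcaHeight f ⌊ i /2⌋ ⌊ j /2⌋)
lcaHeight-≢ f {i} {j} i≢j with i ℕ.≟ j
... | yes i≡j = contradiction i≡j i≢j
... | no  _   = refl

m≤1+n⇒⌊m/2⌋≤n : ∀ {m n} → m ≤ suc n → ⌊ m /2⌋ ≤ n
m≤1+n⇒⌊m/2⌋≤n {n = n} m≤1+n = ≤-pred (≤-<-trans (⌊n/2⌋-mono m≤1+n) (⌊n/2⌋<n n))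

lcaHeight-pos : ∀ f {i j} → i < j → j ≤ f → 0 < lcaHeight f i j
lcaHeight-pos zero    i<j j≤0 = contradiction (<-≤-trans i<j j≤0) n≮0
lcaHeight-pos (suc f) i<j _   rewrite lcaHeight-≢ f (<⇒≢ i<j) = z<s

lcaHeight-⊔ : ∀ f {a b c} → a ≤ b → b ≤ c → c ≤ f →
              lcaHeight f a c ≡ lcaHeight f a b ⊔ lcaHeight f b c
lcaHeight-⊔ zero    _   _   _ = refl
lcaHeight-⊔ (suc f) {a} {b} {c} a≤b b≤c c≤f = split (a ℕ.≟ b) (b ℕ.≟ c)
  where
  open ≡-Reasoning
  h = lcaHeight (suc f)
  split : Dec (a ≡ b) → Dec (b ≡ c) → h a c ≡ h a b ⊔ h b c
  split (yes a≡b) _ = begin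
    h a c            ≡⟨ cong (λ x → h x c) a≡b ⟩
    0 ⊔ h b c        ≡⟨ cong (_⊔ h b c) (lcaHeight-≡ (suc f) a≡b) ⟨
    h a b ⊔ h b c    ∎
  split (no _) (yes b≡c) = begin
    h a c            ≡⟨ cong (h a) b≡c ⟨
    h a b            ≡⟨ ⊔-identityʳ (h a b) ⟨
    h a b ⊔ 0        ≡⟨ cong (h a b ⊔_) (lcaHeight-≡ (suc f) b≡c) ⟨
    h a b ⊔ h b c    ∎
  split (no a≢b) (no b≢c) = begin
    h a c                                      ≡⟨ lcaHeight-≢ f (<⇒≢ (<-≤-trans (≤∧≢⇒< a≤b a≢b) b≤c)) ⟩
    suc (lcaHeight f ⌊ a /2⌋ ⌊ c /2⌋)          ≡⟨ cong suc (lcaHeight-⊔ f (⌊n/2⌋-mono a≤b) (⌊n/2⌋-mono b≤c) (m≤1+n⇒⌊m/2⌋≤n c≤f)) ⟩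
    suc (lcaHeight f ⌊ a /2⌋ ⌊ b /2⌋ ⊔ lcaHeight f ⌊ b /2⌋ ⌊ c /2⌋)
                                               ≡⟨ cong₂ _⊔_ (lcaHeight-≢ f a≢b) (lcaHeight-≢ f b≢c) ⟨
    h a b ⊔ h b c                              ∎

lcaHeight-adjacent-≢ : ∀ f {a b c} → a ≤ b → b ≤ c → a < c → c ≤ f →
                       lcaHeight f a b ≢ lcaHeight f b c
lcaHeight-adjacent-≢ zero _ _ a<c c≤0 _ = contradiction (<-≤-trans a<c c≤0) n≮0
lcaHeight-adjacent-≢ (suc f) {a} {b} {c} a≤b b≤c a<c c≤f = split (a ℕ.≟ b) (b ℕ.≟ c)
  where
  h = lcaHeight (suc f)
  split : Dec (a ≡ b) → Dec (b ≡ c) → h a b ≢ h b c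
  split (yes a≡b) (yes b≡c) _ = <-irrefl (trans a≡b b≡c) a<c
  split (yes a≡b) (no b≢c) eq =
    <-irrefl (trans (sym (lcaHeight-≡ (suc f) a≡b)) eq) (lcaHeight-pos (suc f) (≤∧≢⇒< b≤c b≢c) c≤f)
  split (no a≢b) (yes b≡c) eq =
    <-irrefl (trans (sym (lcaHeight-≡ (suc f) b≡c)) (sym eq)) (lcaHeight-pos (suc f) (≤∧≢⇒< a≤b a≢b) (≤-trans b≤c c≤f))
  split (no a≢b) (no b≢c) eq =
    lcaHeight-adjacent-≢ f (⌊n/2⌋-mono a≤b) (⌊n/2⌋-mono b≤c) ⌊a/2⌋<⌊c/2⌋ (m≤1+n⇒⌊m/2⌋≤n c≤f)
      (suc-injective (trans (sym (lcaHeight-≢ f a≢b)) (trans eq (lcaHeight-≢ f b≢c))))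
    where
    -- a < b < c gives a + 2 ≤ c, which survives halving.
    ⌊a/2⌋<⌊c/2⌋ : ⌊ a /2⌋ < ⌊ c /2⌋
    ⌊a/2⌋<⌊c/2⌋ = ⌊n/2⌋-mono {2 + a} (<-≤-trans (s≤s (≤∧≢⇒< a≤b a≢b)) (≤∧≢⇒< b≤c b≢c))

lcaHeight≤1+⌊log₂⌋ : ∀ f {i j} → i ≤ j → lcaHeight f i j ≤ suc ⌊log₂ j ⌋
lcaHeight≤1+⌊log₂⌋ zero _ = z≤n
lcaHeight≤1+⌊log₂⌋ (suc f) {i} {j} i≤j with i ℕ.≟ j
... | yes _ = z≤n
... | no i≢j = s≤s (halves (≤∧≢⇒< i≤j i≢j))
  where
  halves : ∀ {j} → i < j → lcaHeight f ⌊ i /2⌋ ⌊ j /2⌋ ≤ ⌊log₂ j ⌋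
  halves {suc zero} (s≤s z≤n) = ≤-reflexive (lcaHeight-refl f 0)
  halves {suc (suc k)} i<j = begin
    lcaHeight f ⌊ i /2⌋ ⌊ 2 + k /2⌋  ≤⟨ lcaHeight≤1+⌊log₂⌋ f (⌊n/2⌋-mono (<⇒≤ i<j)) ⟩
    suc ⌊log₂ ⌊ 2 + k /2⌋ ⌋          ≡⟨ cong suc (⌊log₂⌊n/2⌋⌋≡⌊log₂n⌋∸1 (2 + k)) ⟩
    suc (⌊log₂ (2 + k) ⌋ ∸ 1)        ≡⟨ m+[n∸m]≡n {1} (⌊log₂⌋-mono-≤ {2} {2 + k} (s≤s (s≤s z≤n))) ⟩
    ⌊log₂ (2 + k) ⌋                  ∎
    where open ≤-Reasoning

m+x≡n+y⇒m%d≢n%d : ∀ d .{{_ : NonZero d}} {m n x y} →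
                  m + x ≡ n + y → x < d → y < d → x ≢ y → m % d ≢ n % d
m+x≡n+y⇒m%d≢n%d d {m} {n} {x} {y} m+x≡n+y x<d y<d x≢y m%d≡n%d = x≢y (begin
  x                   ≡⟨ m<n⇒m%n≡m x<d ⟨
  x % d               ≡⟨ [m+kn]%n≡m%n x (m / d) d ⟨
  (x + m / d * d) % d ≡⟨ cong (_% d) same-quotient-form ⟩
  (y + n / d * d) % d ≡⟨ [m+kn]%n≡m%n y (n / d) d ⟩
  y % d               ≡⟨ m<n⇒m%n≡m y<d ⟩
  y                   ∎)
  where
  open ≡-Reasoning
  shuffle : ∀ r z s → r + (z + s) ≡ r + s + z
  shuffle = solve-∀
  same-quotient-form : x + m / d * d ≡ y + n / d * d
  same-quotient-form = +-cancelˡ-≡ (m % d) _ _ (begin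
    m % d + (x + m / d * d) ≡⟨ shuffle (m % d) x (m / d * d) ⟩
    m % d + m / d * d + x   ≡⟨ cong (_+ x) (m≡m%n+[m/n]*n m d) ⟨
    m + x                   ≡⟨ m+x≡n+y ⟩
    n + y                   ≡⟨ cong (_+ y) (m≡m%n+[m/n]*n n d) ⟩
    n % d + n / d * d + y   ≡⟨ shuffle (n % d) y (n / d * d) ⟨
    n % d + (y + n / d * d) ≡⟨ cong (_+ (y + n / d * d)) m%d≡n%d ⟨
    m % d + (y + n / d * d) ∎)

m<o∧m⊔n≡o⇒n≡o : ∀ {m n o} → m < o → m ⊔ n ≡ o → n ≡ o
m<o∧m⊔n≡o⇒n≡o {m} {n} m<o m⊔n≡o with ⊔-sel m n
... | inj₁ m⊔n≡m = contradiction (trans (sym m⊔n≡m) m⊔n≡o) (<⇒≢ m<o)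
... | inj₂ m⊔n≡n = trans (sym m⊔n≡n) m⊔n≡o

sum-update : ∀ {n} (f g : Fin n → ℕ) (p : Fin n) → (∀ i → i ≢ p → f i ≡ g i) →
             sum f + g p ≡ sum g + f p
sum-update {suc n} f g p f≐g = begin
  sum f + g p                             ≡⟨ cong (_+ g p) (sum-remove {i = p} f) ⟩
  f p + sum (f ∘ punchIn p) + g p         ≡⟨ cong (λ s → f p + s + g p) (sum-cong-≗ (λ i → f≐g _ (punchInᵢ≢i p i))) ⟩
  f p + sum (g ∘ punchIn p) + g p         ≡⟨ swap-ends (f p) _ (g p) ⟩
  g p + sum (g ∘ punchIn p) + f p         ≡⟨ cong (_+ f p) (sum-remove {i = p} g) ⟨
  sum g + f p                             ∎
  where
  open ≡-Reasoning
  swap-ends : ∀ x s y → x + s + y ≡ y + s + x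
  swap-ends = solve-∀

indicator : Bool → ℕ
indicator m = if m then 1 else 0

sum₂ : ∀ {n} → (Fin n → Fin n → ℕ) → ℕ
sum₂ F = sum (λ i → sum (F i))

sum₂-update : ∀ {n} (F G : Fin n → Fin n → ℕ) (p q : Fin n) →
              (∀ i j → ¬ (i ≡ p × j ≡ q) → F i j ≡ G i j) →
              sum₂ F + G p q ≡ sum₂ G + F p q
sum₂-update F G p q F≐G = +-cancelʳ-≡ (sum (G p)) _ _ (begin
  sum₂ F + G p q + sum (G p)     ≡⟨ swap-last (sum₂ F) (G p q) (sum (G p)) ⟩
  sum₂ F + sum (G p) + G p q     ≡⟨ cong (_+ G p q) rows ⟩
  sum₂ G + sum (F p) + G p q     ≡⟨ +-assoc (sum₂ G) (sum (F p)) (G p q) ⟩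
  sum₂ G + (sum (F p) + G p q)   ≡⟨ cong (sum₂ G +_) row-p ⟩
  sum₂ G + (sum (G p) + F p q)   ≡⟨ +-assoc (sum₂ G) (sum (G p)) (F p q) ⟨
  sum₂ G + sum (G p) + F p q     ≡⟨ swap-last (sum₂ G) (sum (G p)) (F p q) ⟩
  sum₂ G + F p q + sum (G p)     ∎)
  where
  open ≡-Reasoning
  swap-last : ∀ x y z → x + y + z ≡ x + z + y
  swap-last = solve-∀
  rows : sum₂ F + sum (G p) ≡ sum₂ G + sum (F p)
  rows = sum-update _ _ p (λ i i≢p → sum-cong-≗ (λ j → F≐G i j (i≢p ∘ proj₁)))
  row-p : sum (F p) + G p q ≡ sum (G p) + F p q
  row-p = sum-update (F p) (G p) q (λ j j≢q → F≐G p j (j≢q ∘ proj₂))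

module _ {n : ℕ} where

  toℕ<⇒≢ : {x y : Fin n} → toℕ x < toℕ y → x ≢ y
  toℕ<⇒≢ x<y refl = <-irrefl refl x<y

  samePair? : (i j x y : Fin n) → Dec (i ≡ x × j ≡ y)
  samePair? i j x y = (i Fin.≟ x) ×-dec (j Fin.≟ y)

  samePair-refl : (x y : Fin n) → samePair x y x y ≡ true
  samePair-refl x y = dec-true (samePair? x y x y) (refl , refl)

  samePair-≢ : {i j x y : Fin n} → ¬ (i ≡ x × j ≡ y) → samePair i j x y ≡ false
  samePair-≢ {i} {j} {x} {y} = dec-false (samePair? i j x y)

  replace-removed : ∀ E (x y u v : Fin n) → replace E x y u v x y ≡ false
  replace-removed E x y u v rewrite samePair-refl x y = refl

  replace-added : ∀ E (x y u v : Fin n) → ¬ (u ≡ x × v ≡ y) → replace E x y u v u v ≡ true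
  replace-added E x y u v uv≢xy rewrite samePair-≢ uv≢xy | samePair-refl u v = refl

  replace-other : ∀ E {x y u v i j : Fin n} → ¬ (i ≡ x × j ≡ y) → ¬ (i ≡ u × j ≡ v) →
                  replace E x y u v i j ≡ E i j
  replace-other E ij≢xy ij≢uv rewrite samePair-≢ ij≢xy | samePair-≢ ij≢uv = refl

  replace-inverse : ∀ {E E' : Fin n → Fin n → Bool} {x y u v} →
                    (∀ i j → E' i j ≡ replace E x y u v i j) →
                    E x y ≡ true → E u v ≡ false → ¬ (u ≡ x × v ≡ y) →
                    ∀ i j → E i j ≡ replace E' u v x y i j
  replace-inverse {E} {E'} {x} {y} {u} {v} E'≐ xy∈E uv∉E uv≢xy i j
    with samePair? i j u v | samePair? i j x y
  ... | yes (refl , refl) | _ = trans uv∉E (sym (replace-removed E' u v x y))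
  ... | no _ | yes (refl , refl) = trans xy∈E (sym (replace-added E' u v x y (uv≢xy ∘ λ (p , q) → sym p , sym q)))
  ... | no ij≢uv | no ij≢xy =
    sym (trans (replace-other E' ij≢uv ij≢xy) (trans (E'≐ i j) (replace-other E ij≢xy ij≢uv)))

  Boundary⇒¬Cross : {i j k l : Fin n} → Boundary i j → ¬ Cross i j k l
  Boundary⇒¬Cross (inj₁ j≡1+i) (inj₁ (i<k , k<j , _)) = <-irrefl refl (<-≤-trans k<j (subst (_≤ _) (sym j≡1+i) i<k))
  Boundary⇒¬Cross (inj₁ j≡1+i) (inj₂ (_ , i<l , l<j)) = <-irrefl refl (<-≤-trans l<j (subst (_≤ _) (sym j≡1+i) i<l))
  Boundary⇒¬Cross {l = l} (inj₂ (_ , j≡n-1)) (inj₁ (_ , _ , j<l)) = <-irrefl refl (<-≤-trans (toℕ<n l) n≤l)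
    where
    n≤l : n ≤ toℕ l
    n≤l = subst (_≤ toℕ l) (m+[n∸m]≡n {1} (<-≤-trans z<s (toℕ<n l))) (subst (_< toℕ l) j≡n-1 j<l)
  Boundary⇒¬Cross (inj₂ (i≡0 , _)) (inj₂ (k<i , _ , _)) = n≮0 (subst (_ <_) i≡0 k<i)

  Cross-sym : {i j k l : Fin n} → Cross i j k l → Cross k l i j
  Cross-sym (inj₁ c) = inj₂ c
  Cross-sym (inj₂ c) = inj₁ c

  InT⇒¬Cross : (T : Triangulation n) {i j k l : Fin n} → InT T i j → InT T k l → ¬ Cross i j k l
  InT⇒¬Cross T (inj₁ ij∈T) (inj₁ kl∈T) = noncross T _ _ _ _ ij∈T kl∈T
  InT⇒¬Cross T (inj₂ ij-bd) _ = Boundary⇒¬Cross ij-bd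
  InT⇒¬Cross T (inj₁ _) (inj₂ kl-bd) = Boundary⇒¬Cross kl-bd ∘ Cross-sym

  InT-replace : {T T' : Triangulation n} {x y u v : Fin n} →
                (∀ i j → edge T' i j ≡ replace (edge T) x y u v i j) →
                ∀ {i j} → ¬ (i ≡ x × j ≡ y) → InT T i j → InT T' i j
  InT-replace T'≐ _ (inj₂ ij-bd) = inj₂ ij-bd
  InT-replace {T} {T'} {x} {y} {u} {v} T'≐ {i} {j} ij≢xy (inj₁ ij∈T) with samePair? i j u v
  ... | yes (refl , refl) = inj₁ (trans (T'≐ u v) (replace-added (edge T) x y u v ij≢xy))
  ... | no ij≢uv = inj₁ (trans (T'≐ i j) (trans (replace-other (edge T) ij≢xy ij≢uv) ij∈T))

record FlipAt {n : ℕ} (T T' : Triangulation n) (a b c d : Fin n) : Set where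
  field
    a<b : toℕ a < toℕ b
    b<c : toℕ b < toℕ c
    c<d : toℕ c < toℕ d
    ab∈T : InT T a b
    bc∈T : InT T b c
    cd∈T : InT T c d
    ad∈T : InT T a d
    ac∈T : edge T a c ≡ true
    T'-edges : ∀ i j → edge T' i j ≡ replace (edge T) a c b d i j

module _ {n : ℕ} where

  Flip⇒FlipAt : {T T' : Triangulation n} → Flip T T' →
                ∃[ a ] ∃[ b ] ∃[ c ] ∃[ d ] (FlipAt T T' a b c d ⊎ FlipAt T' T a b c d)
  Flip⇒FlipAt (a , b , c , d , a<b , b<c , c<d , ab∈T , bc∈T , cd∈T , ad∈T , inj₁ (ac∈T , T'-edges)) =
    a , b , c , d , inj₁ (record
      { a<b = a<b ; b<c = b<c ; c<d = c<d
      ; ab∈T = ab∈T ; bc∈T = bc∈T ; cd∈T = cd∈T ; ad∈T = ad∈T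
      ; ac∈T = ac∈T ; T'-edges = T'-edges })
  Flip⇒FlipAt {T} {T'} (a , b , c , d , a<b , b<c , c<d , ab∈T , bc∈T , cd∈T , ad∈T , inj₂ (bd∈T , T'-edges)) =
    a , b , c , d , inj₂ (record
      { a<b = a<b ; b<c = b<c ; c<d = c<d
      ; ab∈T = keep (toℕ<⇒≢ a<b ∘ proj₁) ab∈T
      ; bc∈T = keep (toℕ<⇒≢ c<d ∘ proj₂) bc∈T
      ; cd∈T = keep ((toℕ<⇒≢ b<c ∘ sym) ∘ proj₁) cd∈T
      ; ad∈T = keep (toℕ<⇒≢ a<b ∘ proj₁) ad∈T
      ; ac∈T = trans (T'-edges a c) (replace-added (edge T) b d a c (toℕ<⇒≢ a<b ∘ proj₁))
      ; T'-edges = replace-inverse T'-edges bd∈T ac∉T (toℕ<⇒≢ a<b ∘ proj₁) })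
    where
    keep : ∀ {i j} → ¬ (i ≡ b × j ≡ d) → InT T i j → InT T' i j
    keep = InT-replace {T = T} {T' = T'} T'-edges
    ac∉T : edge T a c ≡ false
    ac∉T with edge T a c in ac∈T
    ... | false = refl
    ... | true = contradiction (inj₂ (a<b , b<c , c<d)) (InT⇒¬Cross T (inj₁ bd∈T) (inj₁ ac∈T))

module _ {n : ℕ} where

  level : Fin n → Fin n → ℕ
  level i j = lcaHeight n (toℕ i) (toℕ j)

  level-⊔ : (x y z : Fin n) → toℕ x ≤ toℕ y → toℕ y ≤ toℕ z → level x z ≡ level x y ⊔ level y z
  level-⊔ x y z x≤y y≤z = lcaHeight-⊔ n x≤y y≤z (<⇒≤ (toℕ<n z))

  level-monoˡ : (x y z : Fin n) → toℕ x ≤ toℕ y → toℕ y ≤ toℕ z → level x y ≤ level x z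
  level-monoˡ x y z x≤y y≤z = subst (level x y ≤_) (sym (level-⊔ x y z x≤y y≤z)) (m≤m⊔n _ _)

  level-monoʳ : (x y z : Fin n) → toℕ x ≤ toℕ y → toℕ y ≤ toℕ z → level y z ≤ level x z
  level-monoʳ x y z x≤y y≤z = subst (level y z ≤_) (sym (level-⊔ x y z x≤y y≤z)) (m≤n⊔m _ _)

  level-adjacent-≢ : (x y z : Fin n) → toℕ x < toℕ y → toℕ y < toℕ z → level x y ≢ level y z
  level-adjacent-≢ x y z x<y y<z =
    lcaHeight-adjacent-≢ n (<⇒≤ x<y) (<⇒≤ y<z) (<-trans x<y y<z) (<⇒≤ (toℕ<n z))

  level<2+⌊log₂⌋ : (i j : Fin n) → toℕ i ≤ toℕ j → level i j < 2 + ⌊log₂ n ⌋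
  level<2+⌊log₂⌋ i j i≤j =
    s≤s (≤-trans (lcaHeight≤1+⌊log₂⌋ n i≤j) (s≤s (⌊log₂⌋-mono-≤ (<⇒≤ (toℕ<n j)))))

  EntersAtLevel : Triangulation n → Fin n → Fin n → Set
  EntersAtLevel T l r = ∃[ l' ] (toℕ l' < toℕ r × level l' r ≡ level l r × InT T l' r)

  LeavesAtLevel : Triangulation n → Fin n → Fin n → Set
  LeavesAtLevel T l r = ∃[ r' ] (toℕ l < toℕ r' × toℕ r' < toℕ r × level l r' ≡ level l r × InT T l r')

  Marked : Triangulation n → Fin n → Fin n → Set
  Marked T l r = toℕ l < toℕ r × EntersAtLevel T l r × LeavesAtLevel T l r

  boundary? : (i j : Fin n) → Dec (Boundary i j)
  boundary? i j = (toℕ j ℕ.≟ suc (toℕ i)) ⊎-dec ((toℕ i ℕ.≟ 0) ×-dec (toℕ j ℕ.≟ n ∸ 1))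

  InT? : (T : Triangulation n) (i j : Fin n) → Dec (InT T i j)
  InT? T i j = (edge T i j Bool.≟ true) ⊎-dec boundary? i j

  marked? : (T : Triangulation n) (l r : Fin n) → Dec (Marked T l r)
  marked? T l r =
    (toℕ l ℕ.<? toℕ r) ×-dec
    any? (λ l' → (toℕ l' ℕ.<? toℕ r) ×-dec (level l' r ℕ.≟ level l r) ×-dec InT? T l' r) ×-dec
    any? (λ r' → (toℕ l ℕ.<? toℕ r') ×-dec (toℕ r' ℕ.<? toℕ r) ×-dec (level l r' ℕ.≟ level l r) ×-dec InT? T l r')

  markCount : Triangulation n → ℕ
  markCount T = sum₂ (λ l r → indicator (does (marked? T l r)))

  levelWeight : Triangulation n → Fin n → Fin n → ℕ
  levelWeight T i j = if edge T i j then level i j else 0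

  levelSum : Triangulation n → ℕ
  levelSum T = sum₂ (levelWeight T)

module FlipAtProperties {n : ℕ} {T T' : Triangulation n} {a b c d : Fin n} (φ : FlipAt T T' a b c d) where

  open FlipAt φ

  a<c : toℕ a < toℕ c
  a<c = <-trans a<b b<c

  b<d : toℕ b < toℕ d
  b<d = <-trans b<c c<d

  a<d : toℕ a < toℕ d
  a<d = <-trans a<b b<d

  bd≢ac : ¬ (b ≡ a × d ≡ c)
  bd≢ac = (toℕ<⇒≢ a<b ∘ sym) ∘ proj₁

  bd∉T : edge T b d ≡ false
  bd∉T with edge T b d in bd∈T
  ... | false = refl
  ... | true = contradiction (inj₁ (a<b , b<c , c<d)) (InT⇒¬Cross T (inj₁ ac∈T) (inj₁ bd∈T))

  ac∉T' : edge T' a c ≡ false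
  ac∉T' = trans (T'-edges a c) (replace-removed (edge T) a c b d)

  bd∈T' : edge T' b d ≡ true
  bd∈T' = trans (T'-edges b d) (replace-added (edge T) a c b d bd≢ac)

  ¬InT'-ac : ¬ InT T' a c
  ¬InT'-ac (inj₁ ac∈T') = contradiction (trans (sym ac∉T') ac∈T') λ ()
  ¬InT'-ac (inj₂ ac-bd) = proj₂ (diag T a c ac∈T) ac-bd

  T-edges : ∀ i j → edge T i j ≡ replace (edge T') b d a c i j
  T-edges = replace-inverse T'-edges ac∈T bd∉T bd≢ac

  InT-forward : ∀ {i j} → ¬ (i ≡ a × j ≡ c) → InT T i j → InT T' i j
  InT-forward = InT-replace {T = T} {T' = T'} T'-edges

  InT-backward : ∀ {i j} → ¬ (i ≡ b × j ≡ d) → InT T' i j → InT T i j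
  InT-backward = InT-replace {T = T'} {T' = T} T-edges

  bc∈T' : InT T' b c
  bc∈T' = InT-forward ((toℕ<⇒≢ a<b ∘ sym) ∘ proj₁) bc∈T

  cd∈T' : InT T' c d
  cd∈T' = InT-forward ((toℕ<⇒≢ a<c ∘ sym) ∘ proj₁) cd∈T

  levelSum-flip : levelSum T + level b d ≡ levelSum T' + level a c
  levelSum-flip = begin
    levelSum T + level b d                      ≡⟨ cong (λ w → w + level b d) (+-identityʳ (levelSum T)) ⟨
    levelSum T + 0 + level b d                  ≡⟨ cong (λ w → levelSum T + w + level b d) mid-ac ⟨
    levelSum T + mid a c + level b d            ≡⟨ cong (_+ level b d) (sum₂-update _ _ a c T≐mid) ⟩
    sum₂ mid + levelWeight T a c + level b d    ≡⟨ cong (λ w → sum₂ mid + w + level b d) weight-ac ⟩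
    sum₂ mid + level a c + level b d            ≡⟨ swap-last (sum₂ mid) (level a c) (level b d) ⟩
    sum₂ mid + level b d + level a c            ≡⟨ cong (λ w → sum₂ mid + w + level a c) weight'-bd ⟨
    sum₂ mid + levelWeight T' b d + level a c   ≡⟨ cong (_+ level a c) (sum₂-update _ _ b d mid≐T') ⟩
    levelSum T' + mid b d + level a c           ≡⟨ cong (λ w → levelSum T' + w + level a c) mid-bd ⟩
    levelSum T' + 0 + level a c                 ≡⟨ cong (_+ level a c) (+-identityʳ (levelSum T')) ⟩
    levelSum T' + level a c                     ∎
    where
    open ≡-Reasoning
    swap-last : ∀ x y z → x + y + z ≡ x + z + y
    swap-last = solve-∀
    mid : Fin n → Fin n → ℕ
    mid i j = if samePair i j a c then 0 else levelWeight T i j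
    mid-ac : mid a c ≡ 0
    mid-ac rewrite samePair-refl a c = refl
    mid-bd : mid b d ≡ 0
    mid-bd rewrite samePair-≢ bd≢ac | bd∉T = refl
    weight-ac : levelWeight T a c ≡ level a c
    weight-ac rewrite ac∈T = refl
    weight'-bd : levelWeight T' b d ≡ level b d
    weight'-bd rewrite bd∈T' = refl
    T≐mid : ∀ i j → ¬ (i ≡ a × j ≡ c) → levelWeight T i j ≡ mid i j
    T≐mid i j ij≢ac rewrite samePair-≢ ij≢ac = refl
    mid≐T' : ∀ i j → ¬ (i ≡ b × j ≡ d) → mid i j ≡ levelWeight T' i j
    mid≐T' i j ij≢bd rewrite T'-edges i j with samePair? i j a c
    ... | yes (refl , refl) rewrite samePair-refl a c = refl
    ... | no ij≢ac rewrite samePair-≢ ij≢ac | samePair-≢ ij≢bd = refl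

  module EqualLevels (ac≡bd : level a c ≡ level b d) where

    level-bc : level b c ≡ level a c
    level-bc with level b c ℕ.≟ level a c
    ... | yes bc≡ac = bc≡ac
    ... | no bc≢ac = contradiction (sym cd≡ac) (level-adjacent-≢ a c d a<c c<d)
      where
      bc<ac : level b c < level a c
      bc<ac = ≤∧≢⇒< (level-monoʳ a b c (<⇒≤ a<b) (<⇒≤ b<c)) bc≢ac
      cd≡ac : level c d ≡ level a c
      cd≡ac = m<o∧m⊔n≡o⇒n≡o bc<ac (trans (sym (level-⊔ b c d (<⇒≤ b<c) (<⇒≤ c<d))) (sym ac≡bd))

    level-ab< : level a b < level a c
    level-ab< = ≤∧≢⇒< (level-monoˡ a b c (<⇒≤ a<b) (<⇒≤ b<c))
                      (λ ab≡ac → level-adjacent-≢ a b c a<b b<c (trans ab≡ac (sym level-bc)))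

    level-ad : level a d ≡ level a c
    level-ad = begin
      level a d             ≡⟨ level-⊔ a b d (<⇒≤ a<b) (<⇒≤ b<d) ⟩
      level a b ⊔ level b d ≡⟨ cong (level a b ⊔_) ac≡bd ⟨
      level a b ⊔ level a c ≡⟨ m≤n⇒m⊔n≡n (<⇒≤ level-ab<) ⟩
      level a c             ∎
      where open ≡-Reasoning

    Enters-forward : ∀ {l r} → EntersAtLevel T l r → EntersAtLevel T' l r
    Enters-forward {l} {r} (l' , l'<r , l'r≡lr , l'r∈T) with samePair? l' r a c
    ... | yes (refl , refl) = b , b<c , trans level-bc l'r≡lr , bc∈T'
    ... | no l'r≢ac = l' , l'<r , l'r≡lr , InT-forward l'r≢ac l'r∈T

    Enters-backward : ∀ {l r} → EntersAtLevel T' l r → EntersAtLevel T l r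
    Enters-backward {l} {r} (l' , l'<r , l'r≡lr , l'r∈T') with samePair? l' r b d
    ... | yes (refl , refl) = a , a<d , trans (trans level-ad ac≡bd) l'r≡lr , ad∈T
    ... | no l'r≢bd = l' , l'<r , l'r≡lr , InT-backward l'r≢bd l'r∈T'

    Leaves-backward : ∀ {l r} → LeavesAtLevel T' l r → LeavesAtLevel T l r
    Leaves-backward {l} {r} (r' , l<r' , r'<r , lr'≡lr , lr'∈T') with samePair? l r' b d
    ... | yes (refl , refl) = c , b<c , <-trans c<d r'<r , trans (trans level-bc ac≡bd) lr'≡lr , bc∈T
    ... | no lr'≢bd = r' , l<r' , r'<r , lr'≡lr , InT-backward lr'≢bd lr'∈T'

    -- A witness ac is replaced by ad.  This needs d < r; r < d is impossible, as an edge l'r of T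
    -- at level (a,r) would cross cd (l' < c) or have level at most level c r < level a r.
    Leaves-forward : ∀ {l r} → ¬ (l ≡ a × r ≡ d) → EntersAtLevel T l r →
                     LeavesAtLevel T l r → LeavesAtLevel T' l r
    Leaves-forward {l} {r} lr≢ad enters (r' , l<r' , r'<r , lr'≡lr , lr'∈T) with samePair? l r' a c
    ... | no lr'≢ac = r' , l<r' , r'<r , lr'≡lr , InT-forward lr'≢ac lr'∈T
    ... | yes (refl , refl) with <-cmp (toℕ d) (toℕ r)
    ...   | tri< d<r _ _ = d , a<d , d<r , trans level-ad lr'≡lr , InT-forward ((toℕ<⇒≢ c<d ∘ sym) ∘ proj₂) ad∈T
    ...   | tri≈ _ d≡r _ = contradiction (refl , toℕ-injective (sym d≡r)) lr≢ad
    ...   | tri> _ _ r<d = contradiction enters no-entry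
      where
      cr<ar : level c r < level a r
      cr<ar = ≤∧≢⇒< (level-monoʳ a c r (<⇒≤ a<c) (<⇒≤ r'<r))
                    (λ cr≡ar → level-adjacent-≢ a c r a<c r'<r (trans lr'≡lr (sym cr≡ar)))
      no-entry : ¬ EntersAtLevel T a r
      no-entry (l' , l'<r , l'r≡ar , l'r∈T) with toℕ l' ℕ.<? toℕ c
      ... | yes l'<c = InT⇒¬Cross T l'r∈T cd∈T (inj₁ (l'<c , r'<r , r<d))
      ... | no l'≮c = <-irrefl l'r≡ar (≤-<-trans (level-monoʳ c l' r (≮⇒≥ l'≮c) (<⇒≤ l'<r)) cr<ar)

    Marked-forward : ∀ {l r} → ¬ (l ≡ a × r ≡ d) → Marked T l r → Marked T' l r
    Marked-forward lr≢ad (l<r , enters , leaves) =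
      l<r , Enters-forward enters , Leaves-forward lr≢ad enters leaves

    Marked-backward : ∀ {l r} → Marked T' l r → Marked T l r
    Marked-backward (l<r , enters , leaves) = l<r , Enters-backward enters , Leaves-backward leaves

    Marked-ad : Marked T a d
    Marked-ad = a<d , (a , a<d , refl , ad∈T) , (c , a<c , c<d , sym level-ad , inj₁ ac∈T)

    ¬Marked'-ad : ¬ Marked T' a d
    ¬Marked'-ad (_ , _ , r' , a<r' , r'<d , ar'≡ad , ar'∈T') with toℕ r' ℕ.≤? toℕ b
    ... | yes r'≤b = <-irrefl (trans ar'≡ad level-ad)
                       (≤-<-trans (level-monoˡ a r' b (<⇒≤ a<r') r'≤b) level-ab<)
    ... | no r'≰b with <-cmp (toℕ r') (toℕ c)
    ...   | tri< r'<c _ _ = InT⇒¬Cross T' ar'∈T' bc∈T' (inj₁ (a<b , ≰⇒> r'≰b , r'<c))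
    ...   | tri≈ _ r'≡c _ = ¬InT'-ac (subst (InT T' a) (toℕ-injective r'≡c) ar'∈T')
    ...   | tri> _ _ c<r' = InT⇒¬Cross T' ar'∈T' cd∈T' (inj₁ (a<c , c<r' , r'<d))

    markCount-flip : markCount T + 0 ≡ markCount T' + 1
    markCount-flip = begin
      markCount T + 0                                  ≡⟨ cong (λ m → markCount T + indicator m) T'-ad ⟨
      markCount T + indicator (does (marked? T' a d))  ≡⟨ sum₂-update _ _ a d agree ⟩
      markCount T' + indicator (does (marked? T a d))  ≡⟨ cong (λ m → markCount T' + indicator m) T-ad ⟩
      markCount T' + 1                                 ∎
      where
      open ≡-Reasoning
      T-ad : does (marked? T a d) ≡ true
      T-ad = dec-true (marked? T a d) Marked-ad
      T'-ad : does (marked? T' a d) ≡ false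
      T'-ad = dec-false (marked? T' a d) ¬Marked'-ad
      agree : ∀ l r → ¬ (l ≡ a × r ≡ d) →
              indicator (does (marked? T l r)) ≡ indicator (does (marked? T' l r))
      agree l r lr≢ad =
        cong indicator (does-⇔ (mk⇔ (Marked-forward lr≢ad) Marked-backward) (marked? T l r) (marked? T' l r))

module _ {n : ℕ} (4≤n : 4 ≤ n) where

  private
    L = ⌊log₂ n ⌋
    M = 2 + L

  2*M≤4*L : 2 * M ≤ 4 * L
  2*M≤4*L = begin
    2 * (2 + L) ≤⟨ *-monoʳ-≤ 2 (+-monoˡ-≤ L 2≤L) ⟩
    2 * (L + L) ≡⟨ double-double L ⟩
    4 * L       ∎
    where
    open ≤-Reasoning
    2≤L : 2 ≤ L
    2≤L = subst (_≤ L) (⌊log₂[2^n]⌋≡n 2) (⌊log₂⌋-mono-≤ 4≤n)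
    double-double : ∀ x → 2 * (x + x) ≡ 4 * x
    double-double = solve-∀

  colour : Triangulation n → Fin (4 * L)
  colour T = inject≤ (combine (markCount T mod 2) (levelSum T mod M)) 2*M≤4*L

  colour-injective : ∀ T T' → colour T ≡ colour T' →
                     markCount T % 2 ≡ markCount T' % 2 × levelSum T % M ≡ levelSum T' % M
  colour-injective T T' eq = mod⇒% (markCount T) (markCount T') (proj₁ components≡)
                            , mod⇒% (levelSum T) (levelSum T') (proj₂ components≡)
    where
    components≡ = combine-injective (markCount T mod 2) (levelSum T mod M) (markCount T' mod 2) (levelSum T' mod M)
                                    (inject≤-injective 2*M≤4*L 2*M≤4*L _ _ eq)
    mod⇒% : ∀ m m' {d} .{{_ : NonZero d}} → m mod d ≡ m' mod d → m % d ≡ m' % d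
    mod⇒% m m' {d} eq = trans (sym (toℕ-fromℕ< (m%n<n m d))) (trans (cong toℕ eq) (toℕ-fromℕ< (m%n<n m' d)))

  FlipAt⇒colour-≢ : ∀ {T T' a b c d} → FlipAt T T' a b c d → colour T ≢ colour T'
  FlipAt⇒colour-≢ {T} {T'} {a} {b} {c} {d} φ eq = split (level a c ℕ.≟ level b d)
    where
    open FlipAtProperties φ using (levelSum-flip; a<c; b<d; module EqualLevels)
    split : Dec (level a c ≡ level b d) → ⊥
    split (yes ac≡bd) =
      m+x≡n+y⇒m%d≢n%d 2 {markCount T} {markCount T'} {0} {1} (EqualLevels.markCount-flip ac≡bd)
        z<s (s≤s z<s) (λ ()) (proj₁ (colour-injective T T' eq))
    split (no ac≢bd) =
      m+x≡n+y⇒m%d≢n%d M {levelSum T} {levelSum T'} {level b d} {level a c} levelSum-flip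
        (level<2+⌊log₂⌋ b d (<⇒≤ b<d)) (level<2+⌊log₂⌋ a c (<⇒≤ a<c))
        (ac≢bd ∘ sym) (proj₂ (colour-injective T T' eq))

  colour-proper : ProperColoring n (4 * L) colour
  colour-proper T T' flip = proper-at (Flip⇒FlipAt {T = T} {T' = T'} flip)
    where
    proper-at : ∃[ a ] ∃[ b ] ∃[ c ] ∃[ d ] (FlipAt T T' a b c d ⊎ FlipAt T' T a b c d) →
                colour T ≢ colour T'
    proper-at (_ , _ , _ , _ , inj₁ φ) = FlipAt⇒colour-≢ φ
    proper-at (_ , _ , _ , _ , inj₂ φ) = FlipAt⇒colour-≢ φ ∘ sym

theorem1 : ∃[ K ] (∀ (n : ℕ) → 4 ≤ n → ChromaticAtMost n (K * ⌊log₂ n ⌋))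
theorem1 = 4 , λ n 4≤n → colour 4≤n , colour-proper 4≤n
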